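{- Let $n\ge 1$, let $S\subseteq \{1,2,\ldots,\lfloor n/2\rfloor\}$, and let $G=C_n(S)$. If $a_1,\ldots,a_r\in S$ and $\gcd(a_1,\ldots,a_r)\notin S$, then $G$ is not chordal.
   Context: For $S\subseteq T:=\{1,2,\ldots,\lfloor n/2\rfloor\}$, the circulant graph $C_n(S)$ has vertex set $\mathbb{Z}_n=\{0,\ldots,n-1\}$ and edge set $\{\{i,j\} : |j-i|_n\in S\}$, where $|k|_n=\min\{|k|,n-|k|\}$. A graph is chordal if every cycle of length at least $4$ has a chord, i.e. an edge not in the cycle joining two of its vertices. -}

module Defs where

open import Data.Nat using (ℕ; zero; suc; _≤_; _⊓_; _∸_; _/_; ∣_-_∣)
open import Data.Nat.GCD using (gcd)
open import Data.Fin using (Fin; toℕ)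
open import Data.List using (List; foldr)
open import Data.Product using (Σ; _×_; ∃₂)
open import Data.Sum using (_⊎_)
open import Relation.Nullary using (¬_)
open import Relation.Binary.PropositionalEquality using (_≡_; _≢_)
open import Function.Definitions using (Injective)

circDist : (n : ℕ) → Fin n → Fin n → ℕ
circDist n i j = ∣ toℕ j - toℕ i ∣ ⊓ (n ∸ ∣ toℕ j - toℕ i ∣)

SubsetOfT : (n : ℕ) → (ℕ → Set) → Set
SubsetOfT n S = ∀ s → S s → 1 ≤ s × s ≤ n / 2

Circulant : (n : ℕ) → (ℕ → Set) → Fin n → Fin n → Set
Circulant n S i j = S (circDist n i j)

Consecutive : (k : ℕ) → Fin k → Fin k → Set
Consecutive k i j =
  (toℕ j ≡ suc (toℕ i)) ⊎ (toℕ i ≡ suc (toℕ j)) ⊎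
  ((toℕ i ≡ 0 × suc (toℕ j) ≡ k) ⊎ (toℕ j ≡ 0 × suc (toℕ i) ≡ k))

IsCycle : {V : Set} → (V → V → Set) → (k : ℕ) → (Fin k → V) → Set
IsCycle Adj k v = Injective _≡_ _≡_ v × (∀ i j → Consecutive k i j → Adj (v i) (v j))

HasChord : {V : Set} → (V → V → Set) → (k : ℕ) → (Fin k → V) → Set
HasChord Adj k v = ∃₂ λ i j → i ≢ j × ¬ Consecutive k i j × Adj (v i) (v j)

Chordal : {V : Set} → (V → V → Set) → Set
Chordal Adj = ∀ k → 4 ≤ k → (v : Fin k → _) → IsCycle Adj k v → HasChord Adj k v

gcdList : List ℕ → ℕ
gcdList = foldr gcd 0

module Submission where

-- Suppose G = C_n(S) is chordal.  The translations x ↦ x + g of ℤ_n are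
-- automorphisms of G with σⁿ = id, and they act transitively.  The graph-theoretic
-- part shows that every neighbourhood of a finite chordal graph with such automorphisms
-- is a clique (FiniteGraph.neighbourhood-clique).  Its core is the separation lemma
-- (Graph.Separation): two non-adjacent neighbours of w are not joined by any walk
-- avoiding N[w], as a shortest such walk closes up through w to a chordless cycle.
-- If some vertex had two non-adjacent neighbours, then by transitivity every vertex
-- would; a smallest component of some G − N[y] then yields such a walk, where
-- periodicity excludes neighbours x of c with N[x] ⊊ N[c].
-- Hence the residues x with x ≡ 0 or |x|_n ∈ S, i.e. the closed neighbourhood of 0,
-- are closed under subtraction, so contain the ℕ-linear combinations of the aᵢ and by
-- Bézout their gcd d.  As 1 ≤ d ≤ a₁ ≤ n/2, d is its own circular norm, so d ∈ S.
-- The argument is classical; since the goal is a negation, excluded middle is used in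
-- double-negated form (decidability of S, subsets of Fin n given by predicates).

open import Defs
open import Data.Nat using (ℕ; zero; suc; _+_; _*_; _∸_; _⊓_; _≤_; _<_; z≤n; s≤s; _≤?_; _<?_; _/_; _%_; ∣_-_∣; >-nonZero)
open import Data.Nat.Properties
open import Data.Nat.Induction using (<-rec)
open import Data.Nat.GeneralisedArithmetic using (fold; fold-+)
open import Data.Fin using (Fin; toℕ; fromℕ<) renaming (zero to fzero; suc to fsuc; _≟_ to _≟ᶠ_)
open import Data.Fin.Properties using (toℕ-injective; toℕ<n; toℕ-fromℕ<)
open import Data.Fin.Subset using (Subset; _∈_; ∣_∣; inside; outside)
open import Data.Fin.Subset.Properties using (p⊂q⇒∣p∣<∣q∣)
open import Data.Nat.GCD using (gcd; gcd-GCD; gcd[m,n]∣m; gcd[m,n]≡0⇒m≡0; module Bézout)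
open import Data.Nat.Divisibility using (∣⇒≤)
open import Data.Vec.Base using (_∷_; []; here; there)
open import Data.List using (List; []; _∷_)
open import Data.List.Relation.Unary.All using (All; []; _∷_)
open import Data.Product using (Σ; ∃; ∃₂; _×_; _,_; proj₁; proj₂)
open import Data.Sum using (_⊎_; inj₁; inj₂)
open import Data.Empty using (⊥; ⊥-elim)
open import Function using (_∘_)
open import Relation.Binary.Definitions using (tri<; tri≈; tri>)
open import Relation.Nullary using (¬_; Dec; yes; no)
open import Relation.Nullary.Decidable using (¬¬-excluded-middle)
open import Relation.Binary.PropositionalEquality using (_≡_; _≢_; refl; sym; trans; cong; cong₂; subst; subst₂; module ≡-Reasoning)
open import Relation.Binary.Bundles using (Setoid)
import Relation.Binary.Reasoning.Setoid as SetoidReasoning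
open import Level using (0ℓ)
open import Data.Nat.DivMod using (m%n%n≡m%n; %-distribˡ-+; [m+kn]%n≡m%n; [m+n]%n≡m%n; m%n<n; m%n≤n; m<n⇒m%n≡m; m/n*n≤m)

_◂_ : {V : Set} → V → (ℕ → V) → ℕ → V
(x ◂ f) zero = x
(x ◂ f) (suc k) = f k

Consecutiveℕ : ℕ → ℕ → ℕ → Set
Consecutiveℕ k a b = (b ≡ suc a) ⊎ (a ≡ suc b) ⊎ ((a ≡ 0 × suc b ≡ k) ⊎ (b ≡ 0 × suc a ≡ k))

consecutive-sym : ∀ {k a b} → Consecutiveℕ k a b → Consecutiveℕ k b a
consecutive-sym (inj₁ e) = inj₂ (inj₁ e)
consecutive-sym (inj₂ (inj₁ e)) = inj₁ e
consecutive-sym (inj₂ (inj₂ (inj₁ e))) = inj₂ (inj₂ (inj₂ e))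
consecutive-sym (inj₂ (inj₂ (inj₂ e))) = inj₂ (inj₂ (inj₁ e))

Represents : ∀ {n} → Subset n → (Fin n → Set) → Set
Represents s P = (∀ z → z ∈ s → P z) × (∀ z → P z → z ∈ s)

¬¬-subset : ∀ {n} (P : Fin n → Set) → ¬ ¬ (Σ (Subset n) λ s → Represents s P)
¬¬-subset {zero} P k = k ([] , (λ ()) , (λ ()))
¬¬-subset {suc n} P k = ¬¬-subset (P ∘ fsuc) λ { (s , s⊆P , P⊆s) →
  ¬¬-excluded-middle λ where
    (yes P0) → k (inside ∷ s ,
      (λ { fzero here → P0 ; (fsuc z) (there z∈s) → s⊆P z z∈s }) ,
      (λ { fzero _ → here ; (fsuc z) Pz → there (P⊆s z Pz) }))
    (no ¬P0) → k (outside ∷ s ,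
      (λ { fzero () ; (fsuc z) (there z∈s) → s⊆P z z∈s }) ,
      (λ { fzero P0 → ⊥-elim (¬P0 P0) ; (fsuc z) Pz → there (P⊆s z Pz) })) }

¬¬-decidable-below : ∀ {P : ℕ → Set} b → ¬ ¬ (∀ x → x < b → Dec (P x))
¬¬-decidable-below zero k = k λ x ()
¬¬-decidable-below {P} (suc b) k = ¬¬-decidable-below b λ below →
  ¬¬-excluded-middle λ Pb? → k λ x x<1+b → extend below Pb? x (m<1+n⇒m<n∨m≡n x<1+b)
  where
  extend : (∀ x → x < b → Dec (P x)) → Dec (P b) → ∀ x → x < b ⊎ x ≡ b → Dec (P x)
  extend below _ x (inj₁ x<b) = below x x<b
  extend _ Pb? x (inj₂ refl) = Pb?

¬¬-decidable : ∀ {P : ℕ → Set} b → (∀ x → P x → x < b) → ¬ ¬ (∀ x → Dec (P x))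
¬¬-decidable {P} b bound k = ¬¬-decidable-below b λ below → k λ x → decide below x (x <? b)
  where
  decide : (∀ x → x < b → Dec (P x)) → ∀ x → Dec (x < b) → Dec (P x)
  decide below x (yes x<b) = below x x<b
  decide _ x (no x≮b) = no (x≮b ∘ bound x)

record PeriodicAutomorphism {V : Set} (Adj : V → V → Set) (σ : V → V) : Set where
  field
    preserves : ∀ {x y} → Adj x y → Adj (σ x) (σ y)
    period    : ℕ
    returns   : ∀ x → fold x σ (suc period) ≡ x

module Graph {V : Set} (Adj : V → V → Set)
  (Adj-sym : ∀ {a b} → Adj a b → Adj b a) (Adj-irrefl : ∀ {a} → ¬ Adj a a) where

  infix 4 _∈N[_]

  _∈N[_] : V → V → Set
  r ∈N[ c ] = r ≡ c ⊎ Adj c r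

  -- Reach c a b: a walk from a to b in the graph G − N[c].
  data Reach (c : V) : V → V → Set where
    stay : ∀ {a} → ¬ a ∈N[ c ] → Reach c a a
    move : ∀ {a b d} → ¬ a ∈N[ c ] → Adj a b → Reach c b d → Reach c a d

  module _ {c : V} where

    source-outside : ∀ {a b} → Reach c a b → ¬ a ∈N[ c ]
    source-outside (stay a∉) = a∉
    source-outside (move a∉ _ _) = a∉

    target-outside : ∀ {a b} → Reach c a b → ¬ b ∈N[ c ]
    target-outside (stay b∉) = b∉
    target-outside (move _ _ π) = target-outside π

    _++_ : ∀ {a b d} → Reach c a b → Reach c b d → Reach c a d
    stay _ ++ ρ = ρ
    move a∉ ab π ++ ρ = move a∉ ab (π ++ ρ)

    reverse : ∀ {a b} → Reach c a b → Reach c b a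
    reverse (stay a∉) = stay a∉
    reverse (move a∉ ab π) = reverse π ++ move (source-outside π) (Adj-sym ab) (stay a∉)

    length : ∀ {a b} → Reach c a b → ℕ
    length (stay _) = 0
    length (move _ _ π) = suc (length π)

    -- The vertex sequence of a walk, followed by one further vertex e.
    trace : ∀ {a b} → Reach c a b → V → ℕ → V
    trace (stay {a} _) e = a ◂ λ _ → e
    trace (move {a} _ _ π) e = a ◂ trace π e

    trace-start : ∀ {a b} (π : Reach c a b) e → trace π e 0 ≡ a
    trace-start (stay _) e = refl
    trace-start (move _ _ _) e = refl

    trace-end : ∀ {a b} (π : Reach c a b) e → trace π e (suc (length π)) ≡ e
    trace-end (stay _) e = refl
    trace-end (move _ _ π) e = trace-end π e

    trace-step : ∀ {a b e} (π : Reach c a b) → Adj b e →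
                 ∀ k → k ≤ length π → Adj (trace π e k) (trace π e (suc k))
    trace-step (stay _) be zero _ = be
    trace-step {e = e} (move _ ab π) be zero _ = subst (Adj _) (sym (trace-start π e)) ab
    trace-step (move _ _ π) be (suc k) (s≤s k≤) = trace-step π be k k≤

    trace-outside : ∀ {a b} (π : Reach c a b) e → ∀ k → k ≤ length π → ¬ trace π e k ∈N[ c ]
    trace-outside (stay a∉) e zero _ = a∉
    trace-outside (move a∉ _ _) e zero _ = a∉
    trace-outside (move _ _ π) e (suc k) (s≤s k≤) = trace-outside π e k k≤

  Linked : V → V → Set
  Linked a b = a ≡ b ⊎ Adj a b

  -- A shortest counterexample, closed up through w, would be a chordless cycle
  -- of length at least 4.
  module Separation (chordal : Chordal Adj) {w p q : V} (wp : Adj w p) (wq : Adj w q)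
                    (p≢q : p ≢ q) (p≁q : ¬ Adj p q) where

    record Detour (m : ℕ) (f : ℕ → V) : Set where
      field
        start    : f 0 ≡ p
        end      : f m ≡ q
        steps    : ∀ k → k < m → Adj (f k) (f (suc k))
        interior : ∀ k → 0 < k → k < m → ¬ f k ∈N[ w ]

    Shortcut : ℕ → (ℕ → V) → Set
    Shortcut m f = ∃₂ λ i j → 2 + i ≤ j × j ≤ m × Linked (f i) (f j)

    -- A detour without shortcuts, together with w, forms a cycle of length m + 2
    -- (positions 0 ↦ w, suc k ↦ f k) which has no chord.
    module Closing {m f} (D : Detour m f) (no-shortcut : ¬ Shortcut m f) where
      open Detour D

      cyc : ℕ → V
      cyc = w ◂ f

      position : ∀ k → k ≤ m → k ≡ 0 ⊎ k ≡ m ⊎ (0 < k × k < m)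
      position zero _ = inj₁ refl
      position (suc k) k<m with m≤n⇒m<n∨m≡n k<m
      ... | inj₁ 1+k<m = inj₂ (inj₂ (s≤s z≤n , 1+k<m))
      ... | inj₂ 1+k≡m = inj₂ (inj₁ 1+k≡m)

      w-off-detour : ∀ k → k ≤ m → w ≢ f k
      w-off-detour k k≤m w≡fk with position k k≤m
      ... | inj₁ refl = Adj-irrefl (subst (Adj w) (sym (trans w≡fk start)) wp)
      ... | inj₂ (inj₁ refl) = Adj-irrefl (subst (Adj w) (sym (trans w≡fk end)) wq)
      ... | inj₂ (inj₂ (0<k , k<m)) = interior k 0<k k<m (inj₁ (sym w≡fk))

      w-adjacent-ends : ∀ k → k ≤ m → Adj w (f k) → k ≡ 0 ⊎ k ≡ m
      w-adjacent-ends k k≤m wfk with position k k≤m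
      ... | inj₁ k≡0 = inj₁ k≡0
      ... | inj₂ (inj₁ k≡m) = inj₂ k≡m
      ... | inj₂ (inj₂ (0<k , k<m)) = ⊥-elim (interior k 0<k k<m (inj₂ wfk))

      linked-successor : ∀ {a b} → a < b → b ≤ m → Linked (f a) (f b) → b ≡ suc a
      linked-successor {a} {b} a<b b≤m link with m≤n⇒m<n∨m≡n a<b
      ... | inj₁ 2+a≤b = ⊥-elim (no-shortcut (a , b , 2+a≤b , b≤m , link))
      ... | inj₂ 1+a≡b = sym 1+a≡b

      no-repeat : ∀ {a b} → a < b → b ≤ m → f a ≢ f b
      no-repeat {a} a<b b≤m fa≡fb with linked-successor a<b b≤m (inj₁ fa≡fb)
      ... | refl = Adj-irrefl (subst (Adj (f a)) (sym fa≡fb) (steps a b≤m))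

      detour-injective : ∀ {a b} → a ≤ m → b ≤ m → f a ≡ f b → a ≡ b
      detour-injective {a} {b} a≤m b≤m fa≡fb with <-cmp a b
      ... | tri< a<b _ _ = ⊥-elim (no-repeat a<b b≤m fa≡fb)
      ... | tri≈ _ a≡b _ = a≡b
      ... | tri> _ _ b<a = ⊥-elim (no-repeat b<a a≤m (sym fa≡fb))

      cycle-injective : ∀ {a b} → a < 2 + m → b < 2 + m → cyc a ≡ cyc b → a ≡ b
      cycle-injective {zero} {zero} _ _ _ = refl
      cycle-injective {zero} {suc b} _ (s≤s b<) e = ⊥-elim (w-off-detour b (≤-pred b<) e)
      cycle-injective {suc a} {zero} (s≤s a<) _ e = ⊥-elim (w-off-detour a (≤-pred a<) (sym e))
      cycle-injective {suc a} {suc b} (s≤s a<) (s≤s b<) e =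
        cong suc (detour-injective (≤-pred a<) (≤-pred b<) e)

      cycle-step : ∀ a → a ≤ m → Adj (cyc a) (cyc (suc a))
      cycle-step zero _ = subst (Adj w) (sym start) wp
      cycle-step (suc a) a<m = steps a a<m

      cycle-edge : ∀ {a b} → a < 2 + m → b < 2 + m → Consecutiveℕ (2 + m) a b → Adj (cyc a) (cyc b)
      cycle-edge {a} _ (s≤s b<) (inj₁ refl) = cycle-step a (≤-pred b<)
      cycle-edge {b = b} (s≤s a<) _ (inj₂ (inj₁ refl)) = Adj-sym (cycle-step b (≤-pred a<))
      cycle-edge _ _ (inj₂ (inj₂ (inj₁ (refl , refl)))) = subst (Adj w) (sym end) wq
      cycle-edge _ _ (inj₂ (inj₂ (inj₂ (refl , refl)))) = Adj-sym (subst (Adj w) (sym end) wq)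

      no-chord-at-w : ∀ {b} → suc b < 2 + m → ¬ Consecutiveℕ (2 + m) 0 (suc b) → ¬ Adj w (f b)
      no-chord-at-w {b} (s≤s b<) not-consecutive wfb with w-adjacent-ends b (≤-pred b<) wfb
      ... | inj₁ refl = not-consecutive (inj₁ refl)
      ... | inj₂ refl = not-consecutive (inj₂ (inj₂ (inj₁ (refl , refl))))

      no-chord : ∀ {a b} → a < 2 + m → b < 2 + m → a ≢ b → ¬ Consecutiveℕ (2 + m) a b →
                 ¬ Adj (cyc a) (cyc b)
      no-chord {zero} {zero} _ _ a≢b _ _ = a≢b refl
      no-chord {zero} {suc b} _ b< _ not-consecutive = no-chord-at-w b< not-consecutive
      no-chord {suc a} {zero} a< _ _ not-consecutive =
        no-chord-at-w a< (not-consecutive ∘ consecutive-sym) ∘ Adj-sym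
      no-chord {suc a} {suc b} (s≤s a<) (s≤s b<) a≢b not-consecutive fafb with <-cmp a b
      ... | tri< a<b _ _ = not-consecutive (inj₁ (cong suc (linked-successor a<b (≤-pred b<) (inj₂ fafb))))
      ... | tri≈ _ a≡b _ = a≢b (cong suc a≡b)
      ... | tri> _ _ b<a =
        not-consecutive (inj₂ (inj₁ (cong suc (linked-successor b<a (≤-pred a<) (inj₂ (Adj-sym fafb))))))

      chordless : 2 ≤ m → ⊥
      chordless 2≤m with chordal (2 + m) (+-monoʳ-≤ 2 2≤m) (cyc ∘ toℕ) (injective , edges)
        where
        injective : ∀ {i j} → cyc (toℕ i) ≡ cyc (toℕ j) → i ≡ j
        injective {i} {j} e = toℕ-injective (cycle-injective (toℕ<n i) (toℕ<n j) e)
        edges : ∀ i j → Consecutive (2 + m) i j → Adj (cyc (toℕ i)) (cyc (toℕ j))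
        edges i j = cycle-edge (toℕ<n i) (toℕ<n j)
      ... | i , j , i≢j , not-consecutive , chord =
        no-chord (toℕ<n i) (toℕ<n j) (i≢j ∘ toℕ-injective) not-consecutive chord

    shortcut-free-impossible : ∀ {m f} → Detour m f → ¬ ¬ Shortcut m f
    shortcut-free-impossible {zero} D _ = p≢q (trans (sym start) end) where open Detour D
    shortcut-free-impossible {suc zero} D _ =
      p≁q (subst₂ Adj start end (steps 0 (s≤s z≤n))) where open Detour D
    shortcut-free-impossible {suc (suc m)} D no-shortcut =
      Closing.chordless D no-shortcut (s≤s (s≤s z≤n))

    -- Cutting the segment f (1 + i), …, f (i + e) out of a sequence.
    splice : (ℕ → V) → ℕ → ℕ → ℕ → V
    splice f i e k with k ≤? i
    ... | yes _ = f k
    ... | no _ = f (k + e)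

    splice-≤ : ∀ f i e {k} → k ≤ i → splice f i e k ≡ f k
    splice-≤ f i e {k} k≤i with k ≤? i
    ... | yes _ = refl
    ... | no k≰i = ⊥-elim (k≰i k≤i)

    splice-> : ∀ f i e {k} → i < k → splice f i e k ≡ f (k + e)
    splice-> f i e {k} i<k with k ≤? i
    ... | yes k≤i = ⊥-elim (<⇒≱ i<k k≤i)
    ... | no _ = refl

    splice-detour : ∀ {m f} → Detour m f → ∀ i e r → suc i + e + r ≡ m →
                    Adj (f i) (f (suc i + e)) → Detour (suc i + r) (splice f i e)
    splice-detour {m} {f} D i e r m≡ jump = record
      { start = trans (splice-≤ f i e z≤n) start
      ; end = trans (splice-> f i e (m≤m+n (suc i) r)) (trans (cong f m'+e≡m) end)
      ; steps = step
      ; interior = avoids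
      }
      where
      open Detour D
      m'+e≡m : suc i + r + e ≡ m
      m'+e≡m = trans (trans (+-assoc (suc i) r e) (cong (suc i +_) (+-comm r e)))
                     (trans (sym (+-assoc (suc i) e r)) m≡)
      i<m : i < m
      i<m = subst (i <_) m≡ (≤-trans (m≤m+n (suc i) e) (m≤m+n (suc i + e) r))
      shifted<m : ∀ {k} → k < suc i + r → k + e < m
      shifted<m k< = subst (_ <_) m'+e≡m (+-monoˡ-< e k<)
      step : ∀ k → k < suc i + r → Adj (splice f i e k) (splice f i e (suc k))
      step k k< with <-cmp k i
      ... | tri< k<i _ _ = subst₂ Adj (sym (splice-≤ f i e (<⇒≤ k<i))) (sym (splice-≤ f i e k<i))
                             (steps k (<-trans k<i i<m))
      ... | tri≈ _ refl _ = subst₂ Adj (sym (splice-≤ f i e ≤-refl)) (sym (splice-> f i e ≤-refl)) jump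
      ... | tri> _ _ i<k = subst₂ Adj (sym (splice-> f i e i<k)) (sym (splice-> f i e (m<n⇒m<1+n i<k)))
                             (steps (k + e) (shifted<m k<))
      avoids : ∀ k → 0 < k → k < suc i + r → ¬ splice f i e k ∈N[ w ]
      avoids k 0<k k< with k ≤? i
      ... | yes k≤i = interior k 0<k (≤-<-trans k≤i i<m)
      ... | no k≰i = interior (k + e) (≤-trans 0<k (m≤m+n k e)) (shifted<m k<)

    truncate : ∀ {m f} → Detour m f → ∀ i → i ≤ m → f i ≡ q → Detour i f
    truncate D i i≤m fi≡q = record
      { start = start
      ; end = fi≡q
      ; steps = λ k k<i → steps k (<-≤-trans k<i i≤m)
      ; interior = λ k 0<k k<i → interior k 0<k (<-≤-trans k<i i≤m)
      }
      where open Detour D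

    shorten : ∀ {m f} → Detour m f → Shortcut m f → ∃₂ λ m' f' → m' < m × Detour m' f'
    shorten {m} {f} D (i , j , 2+i≤j , j≤m , inj₂ fi-fj) = jump i j 2+i≤j j≤m fi-fj
      where
      open Detour D
      jump : ∀ i j → 2 + i ≤ j → j ≤ m → Adj (f i) (f j) → ∃₂ λ m' f' → m' < m × Detour m' f'
      jump i j 2+i≤j j≤m fi-fj with m≤n⇒∃[o]m+o≡n 2+i≤j | m≤n⇒∃[o]m+o≡n j≤m
      ... | t , refl | r , refl =
        suc i + r , splice f i (suc t) , s≤s (+-monoˡ-≤ r (m≤m+n (suc i) t)) ,
        splice-detour D i (suc t) r (cong (_+ r) j≡) (subst (Adj (f i) ∘ f) (sym j≡) fi-fj)
        where
        j≡ : suc i + suc t ≡ suc (suc i + t)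
        j≡ = +-suc (suc i) t
    shorten {m} {f} D (i , j , 2+i≤j , j≤m , inj₁ fi≡fj) with m≤n⇒m<n∨m≡n j≤m
    ... | inj₁ j<m = shorten D (i , suc j , m<n⇒m<1+n 2+i≤j , j<m ,
                       inj₂ (subst (λ x → Adj x (f (suc j))) (sym fi≡fj) (Detour.steps D j j<m)))
    ... | inj₂ refl = i , f , i<m , truncate D i (<⇒≤ i<m) (trans fi≡fj (Detour.end D))
      where
      i<m : i < m
      i<m = <-trans (n<1+n i) 2+i≤j

    no-detour : ∀ m f → ¬ Detour m f
    no-detour = <-rec (λ m → ∀ f → ¬ Detour m f) λ m shorter f D →
      ¬¬-excluded-middle λ where
        (yes shortcut) → let (m' , f' , m'<m , D') = shorten D shortcut in shorter m'<m f' D'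
        (no no-shortcut) → shortcut-free-impossible D no-shortcut

    separation : ∀ {a b} → Adj p a → Reach w a b → Adj b q → ⊥
    separation {a} pa π bq = no-detour (2 + length π) (p ◂ trace π q) record
      { start = refl
      ; end = trace-end π q
      ; steps = λ where
          zero _ → subst (Adj p) (sym (trace-start π q)) pa
          (suc k) (s≤s k<) → trace-step π bq k (≤-pred k<)
      ; interior = λ where
          (suc k) _ (s≤s k<) → trace-outside π q k (≤-pred k<)
      }

  record NonSimplicial (c : V) : Set where
    field
      {left right} : V
      left-adj     : Adj c left
      right-adj    : Adj c right
      distinct     : left ≢ right
      apart        : ¬ Adj left right

  module _ {σ : V → V} (A : PeriodicAutomorphism Adj σ) where
    open PeriodicAutomorphism A

    undo : ∀ x → fold (σ x) σ period ≡ x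
    undo x = trans (sym (fold-+ x σ period {1})) (trans (cong (fold x σ) (+-comm period 1)) (returns x))

    iterate-preserves : ∀ k {x y} → Adj x y → Adj (fold x σ k) (fold y σ k)
    iterate-preserves zero xy = xy
    iterate-preserves (suc k) xy = preserves (iterate-preserves k xy)

    reflects : ∀ {x y} → Adj (σ x) (σ y) → Adj x y
    reflects {x} {y} σxy = subst₂ Adj (undo x) (undo y) (iterate-preserves period σxy)

    injective : ∀ {x y} → σ x ≡ σ y → x ≡ y
    injective {x} {y} σx≡σy = trans (sym (undo x)) (trans (cong (λ z → fold z σ period) σx≡σy) (undo y))

    preserves-N : ∀ {c r} → r ∈N[ c ] → σ r ∈N[ σ c ]
    preserves-N (inj₁ refl) = inj₁ refl
    preserves-N (inj₂ cr) = inj₂ (preserves cr)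

    transport-non-simplicial : ∀ {c} → NonSimplicial c → NonSimplicial (σ c)
    transport-non-simplicial ns = record
      { left-adj = preserves left-adj
      ; right-adj = preserves right-adj
      ; distinct = distinct ∘ injective
      ; apart = apart ∘ reflects
      }
      where open NonSimplicial ns

    -- σ cannot strictly shrink a closed neighbourhood: if N[σ c] ⊆ N[c] then
    -- N[c] ⊆ N[σ c].  Indeed σ then maps N[c] into itself, hence so does σ^period,
    -- and every r equals σ (σ^period r).
    undominated : ∀ {c} → (∀ {r} → r ∈N[ σ c ] → r ∈N[ c ]) → ∀ {r} → r ∈N[ c ] → r ∈N[ σ c ]
    undominated {c} N[σc]⊆N[c] {r} r∈N[c] =
      subst (_∈N[ σ c ]) (returns r) (preserves-N (stable period))
      where
      stable : ∀ k → fold r σ k ∈N[ c ]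
      stable zero = r∈N[c]
      stable (suc k) = N[σc]⊆N[c] (preserves-N (stable k))

-- In a finite chordal graph on which automorphisms of finite order act transitively,
-- every vertex is simplicial, i.e. every neighbourhood is a clique.  (A special case
-- of Dirac's theorem that chordal graphs have simplicial vertices.)
module FiniteGraph {n : ℕ} (Adj : Fin n → Fin n → Set)
  (Adj-sym : ∀ {a b} → Adj a b → Adj b a) (Adj-irrefl : ∀ {a} → ¬ Adj a a)
  (Adj? : ∀ a b → Dec (Adj a b)) (chordal : Chordal Adj)
  (transitive : ∀ a b → Σ (Fin n → Fin n) λ σ → PeriodicAutomorphism Adj σ × σ a ≡ b)
  where

  open Graph Adj Adj-sym Adj-irrefl

  _∈N[_]? : ∀ r c → Dec (r ∈N[ c ])
  r ∈N[ c ]? with r ≟ᶠ c | Adj? c r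
  ... | yes r≡c | _ = yes (inj₁ r≡c)
  ... | no _ | yes cr = yes (inj₂ cr)
  ... | no r≢c | no c≁r = no λ { (inj₁ r≡c) → r≢c r≡c ; (inj₂ cr) → c≁r cr }

  -- A neighbour x of c with N(x) ⊆ N[c] satisfies N[c] ⊆ N[x] (move c to x by an automorphism).
  undominated-neighbour : ∀ {c x} → Adj c x → (∀ r → Adj x r → r ∈N[ c ]) → ∀ {r} → r ∈N[ c ] → r ∈N[ x ]
  undominated-neighbour {c} {x} cx N⟨x⟩⊆N[c] with transitive c x
  ... | σ , A , refl = undominated A N[σc]⊆N[c]
    where
    N[σc]⊆N[c] : ∀ {r} → r ∈N[ σ c ] → r ∈N[ c ]
    N[σc]⊆N[c] (inj₁ refl) = inj₂ cx
    N[σc]⊆N[c] (inj₂ xr) = N⟨x⟩⊆N[c] _ xr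

  Component : Fin n → Fin n → Subset n → Set
  Component y c s = Represents s (Reach y c)

  -- If every vertex is non-simplicial, no G − N[y] has a component: a smallest
  -- one would give a walk violating the separation lemma.
  module NoSimplicial (everywhere : ∀ c → NonSimplicial c) where

    unreached-off : ∀ {y c v} → ¬ y ∈N[ c ] → ¬ Reach c y v → ¬ v ∈N[ c ] → ¬ v ∈N[ y ]
    unreached-off y∉N[c] unreached v∉N[c] (inj₁ refl) = unreached (stay v∉N[c])
    unreached-off y∉N[c] unreached v∉N[c] (inj₂ yv) = unreached (move y∉N[c] yv (stay v∉N[c]))

    transfer : ∀ {y c a z} → ¬ y ∈N[ c ] → ¬ Reach c y a → Reach c a z → Reach y a z
    transfer y∉N[c] unreached (stay a∉N[c]) = stay (unreached-off y∉N[c] unreached a∉N[c])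
    transfer {y} {c} y∉N[c] unreached (move {b = b} a∉N[c] ab π) =
      move (unreached-off y∉N[c] unreached a∉N[c]) ab (transfer y∉N[c] unreached-b π)
      where
      unreached-b : ¬ Reach c y b
      unreached-b ρ = unreached (ρ ++ move (source-outside π) (Adj-sym ab) (stay a∉N[c]))

    escapes : ∀ {c x z} → Adj c x → Adj c z → x ≢ z → ¬ Adj x z → ¬ (∀ r → Adj x r → r ∈N[ c ])
    escapes cx cz x≢z x≁z N⟨x⟩⊆N[c] with undominated-neighbour cx N⟨x⟩⊆N[c] (inj₂ cz)
    ... | inj₁ z≡x = x≢z (sym z≡x)
    ... | inj₂ xz = x≁z xz

    Smaller : Subset n → Set
    Smaller s = ∀ {y' c' s'} → ∣ s' ∣ < ∣ s ∣ → ¬ c' ∈N[ y' ] → ¬ Component y' c' s'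

    -- Both non-adjacent neighbours of c have a neighbour that y reaches in G − N[c];
    -- joining these walks contradicts the separation lemma at c.
    shrink : ∀ {y c s} → ¬ c ∈N[ y ] → Component y c s → ¬ Smaller s
    shrink {y} {c} {s} c∉N[y] (_ , reach⊆s) smaller =
      anchor left-adj (escapes left-adj right-adj distinct apart) λ (p' , left-p' , y⇝p') →
      anchor right-adj (escapes right-adj left-adj (distinct ∘ sym) (apart ∘ Adj-sym)) λ (q' , right-q' , y⇝q') →
      Separation.separation chordal left-adj right-adj distinct apart
        left-p' (reverse y⇝p' ++ y⇝q') (Adj-sym right-q')
      where
      open NonSimplicial (everywhere c)

      y∉N[c] : ¬ y ∈N[ c ]
      y∉N[c] (inj₁ refl) = c∉N[y] (inj₁ refl)
      y∉N[c] (inj₂ cy) = c∉N[y] (inj₂ (Adj-sym cy))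

      -- If y did not reach r, the component of r in G − N[c] would be a proper
      -- part of s (it misses c), contradicting minimality.
      reached : ∀ {x r} → Adj c x → ¬ x ∈N[ y ] → Adj x r → ¬ r ∈N[ c ] → ¬ ¬ Reach c y r
      reached {x} {r} cx x∉N[y] xr r∉N[c] unreached =
        ¬¬-subset (Reach c r) λ (s' , s'⊆reach , reach⊆s') →
          smaller (p⊂q⇒∣p∣<∣q∣ (s'⊆s s'⊆reach , c , reach⊆s c (stay c∉N[y]) ,
                                 λ c∈s' → target-outside (s'⊆reach c c∈s') (inj₁ refl)))
                  r∉N[c] (s'⊆reach , reach⊆s')
        where
        s'⊆s : ∀ {s'} → (∀ z → z ∈ s' → Reach c r z) → ∀ {z} → z ∈ s' → z ∈ s
        s'⊆s s'⊆reach {z} z∈s' =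
          reach⊆s z (move c∉N[y] cx (move x∉N[y] xr (transfer y∉N[c] unreached (s'⊆reach z z∈s'))))

      anchor : ∀ {x} → Adj c x → ¬ (∀ r → Adj x r → r ∈N[ c ]) →
               ¬ ¬ (∃ λ x' → Adj x x' × Reach c y x')
      anchor {x} cx escape found with x ∈N[ y ]?
      ... | yes (inj₁ refl) = y∉N[c] (inj₂ cx)
      ... | yes (inj₂ yx) = found (y , Adj-sym yx , stay y∉N[c])
      ... | no x∉N[y] = escape λ r xr → case-outside r xr (r ∈N[ c ]?)
        where
        case-outside : ∀ r → Adj x r → Dec (r ∈N[ c ]) → r ∈N[ c ]
        case-outside r xr (yes r∈N[c]) = r∈N[c]
        case-outside r xr (no r∉N[c]) =
          ⊥-elim (reached cx x∉N[y] xr r∉N[c] λ y⇝r → found (r , xr , y⇝r))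

    no-component : ∀ {y c s} → ¬ c ∈N[ y ] → ¬ Component y c s
    no-component {s = s} = <-rec P step ∣ s ∣ refl
      where
      P : ℕ → Set
      P k = ∀ {y c s} → ∣ s ∣ ≡ k → ¬ c ∈N[ y ] → ¬ Component y c s
      step : ∀ k → (∀ {k'} → k' < k → P k') → P k
      step k smaller-k refl c∉N[y] comp =
        shrink c∉N[y] comp λ lt c'∉N[y'] comp' → smaller-k lt refl c'∉N[y'] comp'

  all-simplicial : ∀ c → ¬ NonSimplicial c
  all-simplicial c₀ ns = ¬¬-subset (Reach left right) λ (s , comp) →
    NoSimplicial.no-component everywhere right∉N[left] comp
    where
    open NonSimplicial ns
    everywhere : ∀ c → NonSimplicial c
    everywhere c with transitive c₀ c
    ... | σ , A , refl = transport-non-simplicial A ns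
    right∉N[left] : ¬ right ∈N[ left ]
    right∉N[left] (inj₁ right≡left) = distinct (sym right≡left)
    right∉N[left] (inj₂ left-right) = apart left-right

  neighbourhood-clique : ∀ {c s t} → Adj c s → Adj c t → s ≡ t ⊎ Adj s t
  neighbourhood-clique {c} {s} {t} cs ct with s ≟ᶠ t | Adj? s t
  ... | yes s≡t | _ = inj₁ s≡t
  ... | no _ | yes st = inj₂ st
  ... | no s≢t | no s≁t = ⊥-elim (all-simplicial c record
    { left-adj = cs ; right-adj = ct ; distinct = s≢t ; apart = s≁t })

module Residues (n₁ : ℕ) where

  n : ℕ
  n = suc n₁

  infix 4 _≈_
  -- Congruence modulo n (a record, so that both sides can be inferred).
  record _≈_ (a b : ℕ) : Set where
    constructor by-mod
    field mods : a % n ≡ b % n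

  ≈-refl : ∀ {a} → a ≈ a
  ≈-refl = by-mod refl

  ≈-sym : ∀ {a b} → a ≈ b → b ≈ a
  ≈-sym (by-mod e) = by-mod (sym e)

  ≈-trans : ∀ {a b c} → a ≈ b → b ≈ c → a ≈ c
  ≈-trans (by-mod e) (by-mod e') = by-mod (trans e e')

  ≈-setoid : Setoid 0ℓ 0ℓ
  ≈-setoid = record { _≈_ = _≈_ ; isEquivalence = record { refl = ≈-refl ; sym = ≈-sym ; trans = ≈-trans } }

  module ≈-Reasoning = SetoidReasoning ≈-setoid
  open ≈-Reasoning

  ≡⇒≈ : ∀ {a b} → a ≡ b → a ≈ b
  ≡⇒≈ e = by-mod (cong (_% n) e)

  %-≈ : ∀ a → a % n ≈ a
  %-≈ a = by-mod (m%n%n≡m%n a n)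

  +-cong : ∀ {a a' b b'} → a ≈ a' → b ≈ b' → a + b ≈ a' + b'
  +-cong {a} {a'} {b} {b'} (by-mod a≡a') (by-mod b≡b') = by-mod
    (trans (%-distribˡ-+ a b n)
      (trans (cong₂ (λ x y → (x + y) % n) a≡a' b≡b') (sym (%-distribˡ-+ a' b' n))))

  multiple : ∀ a k → a + k * n ≈ a
  multiple a k = by-mod ([m+kn]%n≡m%n a k n)

  +n-≈ : ∀ a → a + n ≈ a
  +n-≈ a = by-mod ([m+n]%n≡m%n a n)

  neg : ℕ → ℕ
  neg a = n ∸ a % n

  +-inverse : ∀ a → a + neg a ≈ 0
  +-inverse a = begin
    a + neg a        ≈⟨ +-cong (≈-sym (%-≈ a)) ≈-refl ⟩
    a % n + neg a    ≡⟨ m+[n∸m]≡n (m%n≤n a n) ⟩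
    0 + n            ≈⟨ +n-≈ 0 ⟩
    0                ∎

  cancelʳ : ∀ {a b} c → a + c ≈ b + c → a ≈ b
  cancelʳ {a} {b} c a+c≈b+c = begin
    a                   ≡⟨ +-identityʳ a ⟨
    a + 0               ≈⟨ +-cong ≈-refl (+-inverse c) ⟨
    a + (c + neg c)     ≡⟨ +-assoc a c (neg c) ⟨
    a + c + neg c       ≈⟨ +-cong a+c≈b+c ≈-refl ⟩
    b + c + neg c       ≡⟨ +-assoc b c (neg c) ⟩
    b + (c + neg c)     ≈⟨ +-cong ≈-refl (+-inverse c) ⟩
    b + 0               ≡⟨ +-identityʳ b ⟩
    b                   ∎

  minus : ℕ → ℕ → ℕ
  minus u v = u + neg v

  minus-+ : ∀ u v → minus u v + v ≈ u
  minus-+ u v = begin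
    u + neg v + v       ≡⟨ +-assoc u (neg v) v ⟩
    u + (neg v + v)     ≡⟨ cong (u +_) (+-comm (neg v) v) ⟩
    u + (v + neg v)     ≈⟨ +-cong ≈-refl (+-inverse v) ⟩
    u + 0               ≡⟨ +-identityʳ u ⟩
    u                   ∎

  minus-unique : ∀ {a u v} → a + v ≈ u → a ≈ minus u v
  minus-unique {a} {u} {v} a+v≈u = cancelʳ v (≈-trans a+v≈u (≈-sym (minus-+ u v)))

  residue-unique : ∀ {a b} → a < n → b < n → a ≈ b → a ≡ b
  residue-unique a<n b<n (by-mod e) = trans (sym (m<n⇒m%n≡m a<n)) (trans e (m<n⇒m%n≡m b<n))

  ⟦_⟧ : ℕ → Fin n
  ⟦ a ⟧ = fromℕ< (m%n<n a n)

  toℕ-⟦⟧ : ∀ a → toℕ ⟦ a ⟧ ≈ a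
  toℕ-⟦⟧ a = ≈-trans (≡⇒≈ (toℕ-fromℕ< (m%n<n a n))) (%-≈ a)

  ⟦⟧-cong : ∀ {a b} → a ≈ b → ⟦ a ⟧ ≡ ⟦ b ⟧
  ⟦⟧-cong {a} {b} (by-mod e) =
    toℕ-injective (trans (toℕ-fromℕ< (m%n<n a n)) (trans e (sym (toℕ-fromℕ< (m%n<n b n)))))

  ⟦⟧-injective : ∀ {a b} → ⟦ a ⟧ ≡ ⟦ b ⟧ → a ≈ b
  ⟦⟧-injective {a} {b} e = ≈-trans (≈-sym (toℕ-⟦⟧ a)) (≈-trans (≡⇒≈ (cong toℕ e)) (toℕ-⟦⟧ b))

  ⟦toℕ⟧ : ∀ i → ⟦ toℕ i ⟧ ≡ i
  ⟦toℕ⟧ i = toℕ-injective (trans (toℕ-fromℕ< (m%n<n (toℕ i) n)) (m<n⇒m%n≡m (toℕ<n i)))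

module CirculantGraph (n₁ : ℕ) (S : ℕ → Set) (S⊆T : SubsetOfT (suc n₁) S) where
  open Residues n₁

  Adj : Fin n → Fin n → Set
  Adj = Circulant n S

  norm : ℕ → ℕ
  norm r = r ⊓ (n ∸ r)

  circDist-residue : ∀ i j r → r + toℕ i ≈ toℕ j → circDist n i j ≡ norm (r % n)
  circDist-residue i j r r+i≈j with toℕ i ≤? toℕ j
  ... | yes i≤j = begin
    norm ∣ toℕ j - toℕ i ∣     ≡⟨ cong norm (m≤n⇒∣n-m∣≡n∸m i≤j) ⟩
    norm (toℕ j ∸ toℕ i)       ≡⟨ cong norm (residue-unique (m%n<n r n) j∸i<n r%n≈j∸i) ⟨
    norm (r % n)               ∎
    where
    open ≡-Reasoning
    j∸i<n : toℕ j ∸ toℕ i < n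
    j∸i<n = ≤-<-trans (m∸n≤m (toℕ j) (toℕ i)) (toℕ<n j)
    r%n≈j∸i : r % n ≈ toℕ j ∸ toℕ i
    r%n≈j∸i = ≈-trans (%-≈ r) (cancelʳ (toℕ i) (≈-trans r+i≈j (≡⇒≈ (sym (m∸n+n≡m i≤j)))))
  ... | no i≰j = begin
    norm ∣ toℕ j - toℕ i ∣     ≡⟨ cong norm (m≤n⇒∣m-n∣≡n∸m (<⇒≤ j<i)) ⟩
    d ⊓ (n ∸ d)                ≡⟨ ⊓-comm d (n ∸ d) ⟩
    (n ∸ d) ⊓ d                ≡⟨ cong ((n ∸ d) ⊓_) (m∸[m∸n]≡n d≤n) ⟨
    norm (n ∸ d)               ≡⟨ cong norm (residue-unique (m%n<n r n) n∸d<n r%n≈n∸d) ⟨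
    norm (r % n)               ∎
    where
    open ≡-Reasoning
    j<i = ≰⇒> i≰j
    d = toℕ i ∸ toℕ j
    d≤n : d ≤ n
    d≤n = ≤-trans (m∸n≤m (toℕ i) (toℕ j)) (<⇒≤ (toℕ<n i))
    n∸d<n : n ∸ d < n
    n∸d<n = ∸-monoʳ-< (m<n⇒0<n∸m j<i) d≤n
    n∸d+i≡n+j : n ∸ d + toℕ i ≡ n + toℕ j
    n∸d+i≡n+j = begin
      n ∸ d + toℕ i             ≡⟨ cong (n ∸ d +_) (m∸n+n≡m (<⇒≤ j<i)) ⟨
      n ∸ d + (d + toℕ j)       ≡⟨ +-assoc (n ∸ d) d (toℕ j) ⟨
      n ∸ d + d + toℕ j         ≡⟨ cong (_+ toℕ j) (m∸n+n≡m d≤n) ⟩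
      n + toℕ j                 ∎
    r%n≈n∸d : r % n ≈ n ∸ d
    r%n≈n∸d = ≈-trans (%-≈ r) (cancelʳ (toℕ i) (≈-trans r+i≈j (≈-sym n∸d+i≈j)))
      where
      n∸d+i≈j : n ∸ d + toℕ i ≈ toℕ j
      n∸d+i≈j = ≈-trans (≡⇒≈ (trans n∸d+i≡n+j (+-comm n (toℕ j)))) (+n-≈ (toℕ j))

  Adj-sym : ∀ {a b} → Adj a b → Adj b a
  Adj-sym {a} {b} = subst S (cong norm (∣-∣-comm (toℕ b) (toℕ a)))

  -- 0 ∉ S, so there are no loops.
  Adj-irrefl : ∀ {a} → ¬ Adj a a
  Adj-irrefl {a} Saa = 1+n≰n (≤-trans (proj₁ (S⊆T _ Saa)) (≤-reflexive (cong norm (∣n-n∣≡0 (toℕ a)))))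

  translate : ℕ → Fin n → Fin n
  translate g x = ⟦ toℕ x + g ⟧

  translate-difference : ∀ g {r x y} → r + toℕ x ≈ toℕ y → r + toℕ (translate g x) ≈ toℕ (translate g y)
  translate-difference g {r} {x} {y} r+x≈y = begin
    r + toℕ (translate g x)  ≈⟨ +-cong ≈-refl (toℕ-⟦⟧ (toℕ x + g)) ⟩
    r + (toℕ x + g)          ≡⟨ +-assoc r (toℕ x) g ⟨
    r + toℕ x + g            ≈⟨ +-cong r+x≈y ≈-refl ⟩
    toℕ y + g                ≈⟨ toℕ-⟦⟧ (toℕ y + g) ⟨
    toℕ (translate g y)      ∎
    where open ≈-Reasoning

  translate-circDist : ∀ g x y → circDist n (translate g x) (translate g y) ≡ circDist n x y
  translate-circDist g x y = begin
    circDist n (translate g x) (translate g y)  ≡⟨ circDist-residue _ _ r (translate-difference g {r} {x} r+x≈y) ⟩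
    norm (r % n)                                ≡⟨ circDist-residue x y r r+x≈y ⟨
    circDist n x y                              ∎
    where
    open ≡-Reasoning
    r = minus (toℕ y) (toℕ x)
    r+x≈y = minus-+ (toℕ y) (toℕ x)

  translate-iterate : ∀ g x k → fold x (translate g) k ≡ ⟦ toℕ x + k * g ⟧
  translate-iterate g x zero = sym (trans (⟦⟧-cong (≡⇒≈ (+-identityʳ (toℕ x)))) (⟦toℕ⟧ x))
  translate-iterate g x (suc k) = trans (cong (translate g) (translate-iterate g x k)) (⟦⟧-cong (begin
    toℕ ⟦ toℕ x + k * g ⟧ + g   ≈⟨ +-cong (toℕ-⟦⟧ (toℕ x + k * g)) ≈-refl ⟩
    toℕ x + k * g + g           ≡⟨ +-assoc (toℕ x) (k * g) g ⟩
    toℕ x + (k * g + g)         ≡⟨ cong (toℕ x +_) (+-comm (k * g) g) ⟩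
    toℕ x + suc k * g           ∎))
    where open ≈-Reasoning

  translate-automorphism : ∀ g → PeriodicAutomorphism Adj (translate g)
  translate-automorphism g = record
    { preserves = λ {x} {y} → subst S (sym (translate-circDist g x y))
    ; period = n₁
    ; returns = λ x → trans (translate-iterate g x n)
        (trans (⟦⟧-cong (≈-trans (≡⇒≈ (cong (toℕ x +_) (*-comm n g))) (multiple (toℕ x) g))) (⟦toℕ⟧ x))
    }

  translate-onto : ∀ a b → translate (minus (toℕ b) (toℕ a)) a ≡ b
  translate-onto a b =
    trans (⟦⟧-cong (≈-trans (≡⇒≈ (+-comm (toℕ a) _)) (minus-+ (toℕ b) (toℕ a)))) (⟦toℕ⟧ b)

  transitive : ∀ a b → Σ (Fin n → Fin n) λ σ → PeriodicAutomorphism Adj σ × σ a ≡ b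
  transitive a b = translate (minus (toℕ b) (toℕ a)) , translate-automorphism _ , translate-onto a b

  open Graph Adj (λ {a} {b} → Adj-sym {a} {b}) (λ {a} → Adj-irrefl {a}) using (_∈N[_]; preserves-N)

  Near : ℕ → Set
  Near x = ⟦ x ⟧ ∈N[ ⟦ 0 ⟧ ]

  Near-≈ : ∀ {a b} → a ≈ b → Near a → Near b
  Near-≈ a≈b = subst (_∈N[ ⟦ 0 ⟧ ]) (⟦⟧-cong a≈b)

  small<n : ∀ a → a + a ≤ n → a < n
  small<n zero _ = s≤s z≤n
  small<n (suc a) 2a≤n = <-≤-trans (m<m+n (suc a) (s≤s z≤n)) 2a≤n

  circDist-from-0 : ∀ a → a + a ≤ n → circDist n ⟦ 0 ⟧ ⟦ a ⟧ ≡ a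
  circDist-from-0 a 2a≤n = begin
    circDist n ⟦ 0 ⟧ ⟦ a ⟧  ≡⟨ circDist-residue ⟦ 0 ⟧ ⟦ a ⟧ a a+0≈a ⟩
    norm (a % n)            ≡⟨ cong norm (m<n⇒m%n≡m (small<n a 2a≤n)) ⟩
    a ⊓ (n ∸ a)             ≡⟨ m≤n⇒m⊓n≡m (m+n≤o⇒m≤o∸n a 2a≤n) ⟩
    a                       ∎
    where
    open ≡-Reasoning
    a+0≈a : a + toℕ ⟦ 0 ⟧ ≈ toℕ ⟦ a ⟧
    a+0≈a = ≈-trans (+-cong ≈-refl (toℕ-⟦⟧ 0)) (≈-trans (≡⇒≈ (+-identityʳ a)) (≈-sym (toℕ-⟦⟧ a)))

  S-small : ∀ {a} → S a → a + a ≤ n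
  S-small {a} Sa = ≤-trans (+-mono-≤ a≤n/2 a≤n/2) (subst (_≤ n) (half+half (n / 2)) (m/n*n≤m n 2))
    where
    a≤n/2 = proj₂ (S⊆T a Sa)
    half+half : ∀ h → h * 2 ≡ h + h
    half+half h = trans (*-comm h 2) (cong (h +_) (+-identityʳ h))

  S-Near : ∀ {a} → S a → Near a
  S-Near {a} Sa = inj₂ (subst S (sym (circDist-from-0 a (S-small Sa))) Sa)

  Near-S : ∀ {a} → 0 < a → a + a ≤ n → Near a → S a
  Near-S {a} 0<a 2a≤n (inj₁ ⟦a⟧≡⟦0⟧) = ⊥-elim (<⇒≢ 0<a (sym a≡0))
    where
    a≡0 : a ≡ 0
    a≡0 = residue-unique (small<n a 2a≤n) (s≤s z≤n) (⟦⟧-injective {a} {0} ⟦a⟧≡⟦0⟧)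
  Near-S {a} 0<a 2a≤n (inj₂ adj) = subst S (circDist-from-0 a 2a≤n) adj

  -- If C_n(S) is chordal, Near is closed under subtraction, hence contains all
  -- ℕ-linear combinations of its elements and in particular their gcds.
  module WhenChordal (S? : ∀ x → Dec (S x)) (chordal : Chordal Adj) where

    Adj? : ∀ a b → Dec (Adj a b)
    Adj? a b = S? (circDist n a b)

    open FiniteGraph Adj (λ {a} {b} → Adj-sym {a} {b}) (λ {a} → Adj-irrefl {a}) Adj? chordal transitive
      using (neighbourhood-clique)

    closed-neighbourhood-clique : ∀ {c a b} → a ∈N[ c ] → b ∈N[ c ] → b ∈N[ a ]
    closed-neighbourhood-clique (inj₁ refl) b∈N[c] = b∈N[c]
    closed-neighbourhood-clique {c} {a} (inj₂ ca) (inj₁ refl) = inj₂ (Adj-sym {c} {a} ca)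
    closed-neighbourhood-clique (inj₂ ca) (inj₂ cb) with neighbourhood-clique ca cb
    ... | inj₁ a≡b = inj₁ (sym a≡b)
    ... | inj₂ ab = inj₂ ab

    -- Translating by −x moves ⟦x⟧ to ⟦0⟧ and ⟦y⟧ to ⟦y − x⟧.
    Near-minus : ∀ x y → Near x → Near y → Near (minus y x)
    Near-minus x y Nx Ny =
      subst₂ _∈N[_] (⟦⟧-cong (+-cong (toℕ-⟦⟧ y) ≈-refl))
                    (⟦⟧-cong (≈-trans (+-cong (toℕ-⟦⟧ x) ≈-refl) (+-inverse x)))
                    (preserves-N (translate-automorphism (neg x)) (closed-neighbourhood-clique Nx Ny))

    Near-0 : Near 0
    Near-0 = inj₁ refl

    Near-+ : ∀ x y → Near x → Near y → Near (x + y)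
    Near-+ x y Nx Ny = Near-≈ (≈-sym x+y≈) (Near-minus (minus 0 y) x (Near-minus y 0 Ny Near-0) Nx)
      where
      open ≈-Reasoning
      x+y≈ : x + y ≈ minus x (minus 0 y)
      x+y≈ = minus-unique (begin
        x + y + (0 + neg y)   ≡⟨ +-assoc x y (neg y) ⟩
        x + (y + neg y)       ≈⟨ +-cong ≈-refl (+-inverse y) ⟩
        x + 0                 ≡⟨ +-identityʳ x ⟩
        x                     ∎)

    Near-* : ∀ k x → Near x → Near (k * x)
    Near-* zero x Nx = Near-0
    Near-* (suc k) x Nx = Near-+ x (k * x) Nx (Near-* k x Nx)

    -- Bézout: gcd a b + v·b = u·a (or symmetrically), so gcd a b ≈ u·a − v·b.
    Near-gcd : ∀ a b → Near a → Near b → Near (gcd a b)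
    Near-gcd a b Na Nb with Bézout.identity (gcd-GCD a b)
    ... | Bézout.+- u v eq =
      Near-≈ (≈-sym (minus-unique {gcd a b} {u * a} {v * b} (≡⇒≈ eq)))
        (Near-minus (v * b) (u * a) (Near-* v b Nb) (Near-* u a Na))
    ... | Bézout.-+ u v eq =
      Near-≈ (≈-sym (minus-unique {gcd a b} {v * b} {u * a} (≡⇒≈ eq)))
        (Near-minus (u * a) (v * b) (Near-* u a Na) (Near-* v b Nb))

    Near-gcdList : ∀ {as} → All S as → Near (gcdList as)
    Near-gcdList [] = Near-0
    Near-gcdList {a ∷ as} (Sa ∷ all-S) = Near-gcd a (gcdList as) (S-Near Sa) (Near-gcdList all-S)

    -- The gcd d of a nonempty list from S satisfies 1 ≤ d ≤ a for its first entry a,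
    -- so d is its own circular norm and Near d means d ∈ S.
    gcd-in-S : ∀ as → as ≢ [] → All S as → S (gcdList as)
    gcd-in-S [] []≢[] _ = ⊥-elim ([]≢[] refl)
    gcd-in-S (a ∷ as) _ all-S@(Sa ∷ _) = Near-S 0<d (≤-trans (+-mono-≤ d≤a d≤a) (S-small Sa)) (Near-gcdList all-S)
      where
      0<a : 0 < a
      0<a = proj₁ (S⊆T a Sa)
      d≤a : gcd a (gcdList as) ≤ a
      d≤a = ∣⇒≤ {{>-nonZero 0<a}} (gcd[m,n]∣m a (gcdList as))
      0<d : 0 < gcd a (gcdList as)
      0<d = n≢0⇒n>0 λ d≡0 → <⇒≢ 0<a (sym (gcd[m,n]≡0⇒m≡0 d≡0))

lemma2p4 : (n : ℕ) → 1 ≤ n → (S : ℕ → Set) → SubsetOfT n S →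
    (as : List ℕ) → as ≢ [] → All S as → ¬ S (gcdList as) →
    ¬ Chordal (Circulant n S)
lemma2p4 (suc n₁) _ S S⊆T as as≢[] all-S gcd∉S chordal =
  ¬¬-decidable (suc (suc n₁ / 2)) (λ x Sx → s≤s (proj₂ (S⊆T x Sx))) λ S? →
    gcd∉S (WhenChordal.gcd-in-S S? chordal as as≢[] all-S)
  where open CirculantGraph n₁ S S⊆T
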